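{- Let $\mathbb{F}$ be a field of positive characteristic $p$ and $S$ an association scheme on a finite set $X$ such that $p\mid k_i$ for every $R_i\in S\setminus O_\vartheta(S)$. If $S$ is $p$-transitive, then $S=O^\vartheta(S)O_\vartheta(S)$.
   Context: $S=\{R_0,\dots,R_d\}$ is an association scheme on $X$ with diagonal $R_0$, transposes $R_{i^*}$, intersection numbers $p_{ij}^k$, valencies $k_i=p_{ii^*}^0$. For nonempty $U,V\subseteq S$, $UV=\{R_k:\exists R_u\in U,R_v\in V,\ p_{uv}^k>0\}$. A nonempty $T\subseteq S$ is closed if $T^*T\subseteq T$ ($T^*=\{R_{i^*}:R_i\in T\}$), strongly normal if also $R_{i^*}TR_i\subseteq T$ for all $i$. $O_\vartheta(S)=\{R_i:k_i=1\}$; $O^\vartheta(S)$ is the intersection of all strongly normal closed subsets. $\overline{A_i}$ is the image in $M_X(\mathbb{F})$ of the adjacency matrix of $R_i$, $\mathbb{F}S=\mathrm{span}_{\mathbb{F}}\{\overline{A_i}\}$, $\overline{k_i}$ the image of $k_i$ in $\mathbb{F}$. A trivial submodule of the regular $\mathbb{F}S$-module is $\langle v\rangle_{\mathbb{F}}$ with $0\ne v\in\mathbb{F}S$ and $\overline{A_i}v=\overline{k_i}v$ for all $i$; $S$ is $p$-transitive if there is exactly one such submodule. -}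

module Defs where

open import Level using (Level; _⊔_; suc)
open import Data.Nat as ℕ using (ℕ; zero; _<_)
open import Data.Bool using (Bool; true; false; if_then_else_)
open import Data.Fin as Fin using (Fin; _≟_)
open import Data.Product using (Σ; ∃; ∃-syntax; _×_; _,_)
open import Relation.Nullary using (¬_)
open import Relation.Nullary.Decidable using (⌊_⌋)
open import Relation.Binary.PropositionalEquality using (_≡_)
open import Algebra.Bundles using (CommutativeRing)

count : ∀ {n} → (Fin n → Bool) → ℕ
count {zero}    f = 0
count {ℕ.suc n} f = (if f Fin.zero then 1 else 0) ℕ.+ count (λ z → f (Fin.suc z))

-- Association schemes on X = Fin n with relations R_0 … R_d
-- (D = d + 1 relations, indexed by Fin D).  A scheme is given by the
-- map rel : X → X → Fin D, rel x y = i  iff (x , y) ∈ R_i.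

record AssocScheme (n d : ℕ) : Set where
  D = ℕ.suc d
  field
    rel     : Fin n → Fin n → Fin D
    nonempty : ∀ (i : Fin D) → ∃[ x ] ∃[ y ] rel x y ≡ i
    diag    : ∀ x y → (rel x y ≡ Fin.zero → x ≡ y) × (x ≡ y → rel x y ≡ Fin.zero)
    star    : Fin D → Fin D
    star-rel : ∀ x y → rel y x ≡ star (rel x y)
    p       : Fin D → Fin D → Fin D → ℕ
    p-count : ∀ (i j : Fin D) (x y : Fin n) →
              count (λ z → ⌊ rel x z ≟ i ⌋ Data.Bool.∧ ⌊ rel z y ≟ j ⌋) ≡ p i j (rel x y)

  k : Fin D → ℕ
  k i = p i (star i) Fin.zero

  Sub : Set₁
  Sub = Fin D → Set

  _·_ : Sub → Sub → Sub
  (U · V) r = ∃[ u ] ∃[ v ] (U u × V v × 0 < p u v r)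

  ⟨_⟩ : Fin D → Sub
  ⟨ i ⟩ j = j ≡ i

  _*ˢ : Sub → Sub
  (T *ˢ) j = ∃[ i ] (T i × j ≡ star i)

  _⊆ˢ_ : Sub → Sub → Set
  U ⊆ˢ V = ∀ r → U r → V r

  Closed : Sub → Set
  Closed T = (∃[ i ] T i) × (((T *ˢ) · T) ⊆ˢ T)

  StronglyNormalClosed : Sub → Set
  StronglyNormalClosed T =
    Closed T × (∀ i → ((⟨ star i ⟩ · T) · ⟨ i ⟩) ⊆ˢ T)

  Othin : Sub
  Othin i = k i ≡ 1

  Oupper : Sub
  -- (subsets of the finite set S are given by characteristic functions)
  Oupper i = ∀ (T : Fin D → Bool) →
             StronglyNormalClosed (λ j → T j ≡ true) → T i ≡ true

record Field (c ℓ : Level) : Set (suc (c ⊔ ℓ)) where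
  field
    commRing : CommutativeRing c ℓ
  open CommutativeRing commRing public
  field
    1≉0     : ¬ (1# ≈ 0#)
    inverse : ∀ x → ¬ (x ≈ 0#) → ∃[ y ] (x * y ≈ 1#)

module FieldOps {c ℓ} (F : Field c ℓ) where
  open Field F

  ι : ℕ → Carrier
  ι zero      = 0#
  ι (ℕ.suc m) = 1# + ι m

  HasChar : ℕ → Set ℓ
  HasChar q = (0 < q) × (ι q ≈ 0#) × (∀ m → 0 < m → m < q → ¬ (ι m ≈ 0#))

  ∑ : ∀ {n} → (Fin n → Carrier) → Carrier
  ∑ {zero}    f = 0#
  ∑ {ℕ.suc n} f = f Fin.zero + ∑ (λ z → f (Fin.suc z))

  Matrix : ℕ → Set c
  Matrix n = Fin n → Fin n → Carrier

module SchemeAlgebra {c ℓ} (F : Field c ℓ) {n d} (S : AssocScheme n d) where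
  open Field F
  open FieldOps F public
  open AssocScheme S

  A̅ : Fin D → Matrix n
  A̅ i x y = if ⌊ rel x y ≟ i ⌋ then 1# else 0#

  _⊗_ : Matrix n → Matrix n → Matrix n
  (M ⊗ N) x y = ∑ (λ z → M x z * N z y)

  InFS : Matrix n → Set (c ⊔ ℓ)
  InFS v = Σ (Fin D → Carrier) λ a → (∀ x y → v x y ≈ ∑ (λ (i : Fin D) → a i * A̅ i x y))

  NonZero : Matrix n → Set ℓ
  NonZero v = ¬ (∀ x y → v x y ≈ 0#)

  -- v spans a trivial submodule of the regular FS-module
  TrivialGen : Matrix n → Set (c ⊔ ℓ)
  TrivialGen v = InFS v × NonZero v ×
    (∀ i x y → (A̅ i ⊗ v) x y ≈ ι (k i) * v x y)

  SameLine : Matrix n → Matrix n → Set (c ⊔ ℓ)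
  SameLine v w = (∃[ λ₁ ] ∀ x y → w x y ≈ λ₁ * v x y) ×
                 (∃[ λ₂ ] ∀ x y → v x y ≈ λ₂ * w x y)

  -- S is p-transitive: exactly one trivial submodule
  PTransitive : Set (c ⊔ ℓ)
  PTransitive = (∃[ v ] TrivialGen v) ×
                (∀ v w → TrivialGen v → TrivialGen w → SameLine v w)

-- Let U = O^ϑ(S) O_ϑ(S), and for a set V of relations let J_V be the 0/1
-- matrix with J_V(x, y) = 1 iff the relation of (x, y) lies in V.  Since
-- R_{i*} R_i ⊆ O^ϑ(S), whether the relation of (z, y) lies in U does not depend
-- on the choice of z in the R_i-neighbourhood of x, so (A_i J_U)(x, y) =
-- k_i J_U(z, y) for any such z.  If R_i is thin, U is stable under left
-- multiplication by R_i and this is k_i J_U(x, y); otherwise p ∣ k_i and both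
-- sides vanish in F.  So J_U, like the all-ones matrix, spans a trivial
-- submodule; by p-transitivity the all-ones matrix is a multiple of J_U, hence
-- J_U has no zero entry and U = S.
module Submission where

open import Defs
open import Level using (Level; 0ℓ)
open import Data.Nat as ℕ using (ℕ; zero; suc; _<_; _<?_; z<s)
open import Data.Nat.Properties using (+-0-commutativeMonoid; *-cancelˡ-≡; <-irrefl)
  renaming (suc-injective to ℕ-suc-injective)
open import Data.Nat.Divisibility using (_∣_; divides)
open import Data.Bool as Bool using (Bool; true; false; if_then_else_; _∧_)
open import Data.Bool.Properties using (¬-not)
open import Data.Vec using (lookup; tabulate)
open import Data.Vec.Properties using (lookup∘tabulate)
open import Data.Fin.Subset using (Subset)
open import Data.Fin.Subset.Properties using (anySubset?)
open import Data.Fin using (Fin; zero; suc; _≟_)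
open import Data.Fin.Properties using (any?; all?; nonZeroIndex; suc-injective; 0≢1+n)
open import Data.Unit using (tt)
open import Data.Product as Product using (_×_; _,_; ∃; ∃-syntax; proj₁; proj₂)
open import Function using (_∘_; id; _⇔_; mk⇔; Equivalence)
open import Relation.Nullary using (¬_; ¬?; Dec; yes; no; does; contradiction)
open import Relation.Nullary.Decidable
  using (dec-true; dec-false; isYes≗does; map′; ⌊_⌋; ⌊⌋-map′; _×-dec_; _→-dec_; does-⇔)
open import Relation.Unary using (Pred; Decidable)
open import Relation.Unary.Properties using (U?)
open import Relation.Binary.PropositionalEquality
  using (_≡_; _≗_; refl; sym; trans; cong; cong₂; subst; module ≡-Reasoning)

open import Algebra.Properties.CommutativeMonoid.Sum +-0-commutativeMonoid
  using (sum; sum-cong-≗; ∑-comm)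

count-cong : ∀ {n} {f g : Fin n → Bool} → f ≗ g → count f ≡ count g
count-cong {zero}  e = refl
count-cong {suc n} e =
  cong₂ ℕ._+_ (cong (λ b → if b then 1 else 0) (e zero)) (count-cong (e ∘ suc))

module _ {p : Level} where

  count-⇔ : ∀ {n} {P Q : Pred (Fin n) p} (P? : Decidable P) (Q? : Decidable Q) →
            (∀ z → P z ⇔ Q z) → count (does ∘ P?) ≡ count (does ∘ Q?)
  count-⇔ P? Q? P⇔Q = count-cong (λ z → does-⇔ (P⇔Q z) (P? z) (Q? z))

  count≡0 : ∀ {n} {P : Pred (Fin n) p} (P? : Decidable P) →
            (∀ z → ¬ P z) → count (does ∘ P?) ≡ 0
  count≡0 {zero}  P? ¬P = refl
  count≡0 {suc n} P? ¬P with P? zero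
  ... | yes Pz = contradiction Pz (¬P zero)
  ... | no _   = count≡0 (P? ∘ suc) (¬P ∘ suc)

  count>0⇒∃ : ∀ {n} {P : Pred (Fin n) p} (P? : Decidable P) →
              0 < count (does ∘ P?) → ∃ P
  count>0⇒∃ {suc n} P? h with P? zero
  ... | yes Pz = zero , Pz
  ... | no _   = Product.map suc id (count>0⇒∃ (P? ∘ suc) h)

  ∃⇒count>0 : ∀ {n} {P : Pred (Fin n) p} (P? : Decidable P) {z} →
              P z → 0 < count (does ∘ P?)
  ∃⇒count>0 P? {zero}  Pz rewrite dec-true (P? zero) Pz = z<s
  ∃⇒count>0 P? {suc z} Pz with P? zero
  ... | yes _ = z<s
  ... | no _  = ∃⇒count>0 (P? ∘ suc) Pz

  count≡0⇒¬ : ∀ {n} {P : Pred (Fin n) p} (P? : Decidable P) →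
              count (does ∘ P?) ≡ 0 → ∀ {z} → ¬ P z
  count≡0⇒¬ P? h Pz = <-irrefl refl (subst (0 <_) h (∃⇒count>0 P? Pz))

  count≡1⇒unique : ∀ {n} {P : Pred (Fin n) p} (P? : Decidable P) →
                   count (does ∘ P?) ≡ 1 → ∀ {a b} → P a → P b → a ≡ b
  count≡1⇒unique P? h {zero}  {zero}  Pa Pb = refl
  count≡1⇒unique P? h {zero}  {suc b} Pa Pb rewrite dec-true (P? zero) Pa =
    contradiction Pb (count≡0⇒¬ (P? ∘ suc) (ℕ-suc-injective h))
  count≡1⇒unique P? h {suc a} {zero}  Pa Pb rewrite dec-true (P? zero) Pb =
    contradiction Pa (count≡0⇒¬ (P? ∘ suc) (ℕ-suc-injective h))
  count≡1⇒unique P? h {suc a} {suc b} Pa Pb with P? zero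
  ... | yes _ = contradiction Pa (count≡0⇒¬ (P? ∘ suc) (ℕ-suc-injective h))
  ... | no _  = cong suc (count≡1⇒unique (P? ∘ suc) h Pa Pb)

  unique⇒count≡1 : ∀ {n} {P : Pred (Fin n) p} (P? : Decidable P) {c} → P c →
                   (∀ {z} → P z → z ≡ c) → count (does ∘ P?) ≡ 1
  unique⇒count≡1 P? {zero} Pc unique rewrite dec-true (P? zero) Pc =
    cong suc (count≡0 (P? ∘ suc) (λ _ Psz → 0≢1+n (sym (unique Psz))))
  unique⇒count≡1 P? {suc c} Pc unique with P? zero
  ... | yes Pz = contradiction (unique Pz) 0≢1+n
  ... | no _   = unique⇒count≡1 (P? ∘ suc) Pc (suc-injective ∘ unique)

count≡sum : ∀ {n} (f : Fin n → Bool) → count f ≡ sum (λ z → if f z then 1 else 0)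
count≡sum {zero}  f = refl
count≡sum {suc n} f = cong ((if f zero then 1 else 0) ℕ.+_) (count≡sum (f ∘ suc))

sum-const : ∀ {m r} (f : Fin m → ℕ) → (∀ a → f a ≡ r) → sum f ≡ m ℕ.* r
sum-const {zero}  f f≡r = refl
sum-const {suc m} f f≡r = cong₂ ℕ._+_ (f≡r zero) (sum-const (f ∘ suc) (f≡r ∘ suc))

double-counting : ∀ {m n r c} (R : Fin m → Fin n → Bool) →
                  (∀ a → count (R a) ≡ r) → (∀ b → count (λ a → R a b) ≡ c) →
                  m ℕ.* r ≡ n ℕ.* c
double-counting {m} {n} {r} {c} R rows cols = begin
  m ℕ.* r                                ≡⟨ sum-const _ rows ⟨
  sum (λ a → count (R a))                ≡⟨ sum-cong-≗ (count≡sum ∘ R) ⟩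
  sum (λ a → sum (λ b → 𝟙 (R a b)))     ≡⟨ ∑-comm (λ a b → 𝟙 (R a b)) ⟩
  sum (λ b → sum (λ a → 𝟙 (R a b)))     ≡⟨ sum-cong-≗ (λ b → count≡sum (λ a → R a b)) ⟨
  sum (λ b → count (λ a → R a b))        ≡⟨ sum-const _ cols ⟩
  n ℕ.* c                                ∎
  where
  open ≡-Reasoning
  𝟙 : Bool → ℕ
  𝟙 b = if b then 1 else 0

module SchemeProperties {n d} (S : AssocScheme n d) where

  open AssocScheme S

  p≡count : ∀ u v x y →
            p u v (rel x y) ≡ count (λ z → does (rel x z ≟ u ×-dec rel z y ≟ v))
  p≡count u v x y =
    trans (sym (p-count u v x y))
      (count-cong (λ z → cong₂ _∧_ (isYes≗does (rel x z ≟ u)) (isYes≗does (rel z y ≟ v))))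

  path⇒p>0 : ∀ {x y z u v} → rel x z ≡ u → rel z y ≡ v → 0 < p u v (rel x y)
  path⇒p>0 {x} {y} {z} {u} {v} xz zy =
    subst (0 <_) (sym (p≡count u v x y))
      (∃⇒count>0 (λ w → rel x w ≟ u ×-dec rel w y ≟ v) (xz , zy))

  p>0⇒path : ∀ {x y u v} → 0 < p u v (rel x y) → ∃[ z ] rel x z ≡ u × rel z y ≡ v
  p>0⇒path {x} {y} {u} {v} h =
    count>0⇒∃ (λ w → rel x w ≟ u ×-dec rel w y ≟ v) (subst (0 <_) (p≡count u v x y) h)

  rel-refl : ∀ x → rel x x ≡ zero
  rel-refl x = proj₂ (diag x x) refl

  star-involutive : ∀ i → star (star i) ≡ i
  star-involutive i with nonempty i
  ... | x , y , refl = sym (trans (star-rel y x) (cong star (star-rel x y)))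

  rel-transpose : ∀ {x y i} → rel x y ≡ i ⇔ rel y x ≡ star i
  rel-transpose {x} {y} {i} = mk⇔ (λ { refl → star-rel x y })
    (λ yx → trans (star-rel y x) (trans (cong star yx) (star-involutive i)))

  k≡count : ∀ i x → k i ≡ count (λ z → does (rel x z ≟ i))
  k≡count i x = begin
    p i (star i) zero                                        ≡⟨ cong (p i (star i)) (rel-refl x) ⟨
    p i (star i) (rel x x)                                   ≡⟨ p≡count i (star i) x x ⟩
    count (λ z → does (rel x z ≟ i ×-dec rel z x ≟ star i))
      ≡⟨ count-⇔ (λ z → rel x z ≟ i ×-dec rel z x ≟ star i) (λ z → rel x z ≟ i) xz-determines-zx ⟩
    count (λ z → does (rel x z ≟ i))                         ∎
    where
    open ≡-Reasoning
    xz-determines-zx : ∀ z → (rel x z ≡ i × rel z x ≡ star i) ⇔ rel x z ≡ i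
    xz-determines-zx z = mk⇔ proj₁ (λ xz → xz , Equivalence.to rel-transpose xz)

  k>0 : ∀ i → 0 < k i
  k>0 i with nonempty i
  ... | x , y , xy = subst (0 <_) (sym (k≡count i x)) (∃⇒count>0 (λ z → rel x z ≟ i) xy)

  successor : ∀ i x → ∃[ z ] rel x z ≡ i
  successor i x = count>0⇒∃ (λ z → rel x z ≟ i) (subst (0 <_) (k≡count i x) (k>0 i))

  k-star : ∀ i → k (star i) ≡ k i
  k-star i = *-cancelˡ-≡ _ _ n {{nonZeroIndex (proj₁ (nonempty zero))}} (sym n*kᵢ≡n*kᵢ*)
    where
    n*kᵢ≡n*kᵢ* : n ℕ.* k i ≡ n ℕ.* k (star i)
    n*kᵢ≡n*kᵢ* = double-counting (λ a b → does (rel a b ≟ i))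
      (λ a → sym (k≡count i a))
      (λ b → trans (count-⇔ (λ a → rel a b ≟ i) (λ a → rel b a ≟ star i) (λ _ → rel-transpose))
                   (sym (k≡count (star i) b)))

  thin-functional : ∀ {i x y z} → Othin i → rel x y ≡ i → rel x z ≡ i → y ≡ z
  thin-functional {i} {x} thin =
    count≡1⇒unique (λ z → rel x z ≟ i) (trans (sym (k≡count i x)) thin)

  Othin-zero : Othin zero
  Othin-zero with nonempty zero
  ... | x , _ = trans (k≡count zero x)
    (unique⇒count≡1 (λ z → rel x z ≟ zero) (rel-refl x) (λ xz → sym (proj₁ (diag x _) xz)))

  Othin-star : ∀ {i} → Othin i → Othin (star i)
  Othin-star {i} = trans (k-star i)

  Othin-comp : ∀ {x y z} → Othin (rel x y) → Othin (rel y z) → Othin (rel x z)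
  Othin-comp {x} {y} {z} xy-thin yz-thin =
    trans (k≡count (rel x z) x) (unique⇒count≡1 (λ w → rel x w ≟ rel x z) refl only-z)
    where
    only-z : ∀ {w} → rel x w ≡ rel x z → w ≡ z
    only-z xw≡xz
      with p>0⇒path (subst (λ t → 0 < p (rel x y) (rel y z) t) (sym xw≡xz) (path⇒p>0 refl refl))
    ... | y′ , xy′ , y′w with thin-functional xy-thin refl xy′
    ... | refl = thin-functional yz-thin y′w refl

  ·-mono : ∀ {U U′ V V′ : Sub} → U ⊆ˢ U′ → V ⊆ˢ V′ → (U · V) ⊆ˢ (U′ · V′)
  ·-mono U⊆U′ V⊆V′ r (u , v , Uu , Vv , h) = u , v , U⊆U′ u Uu , V⊆V′ v Vv , h

  *ˢ-mono : ∀ {T T′ : Sub} → T ⊆ˢ T′ → (T *ˢ) ⊆ˢ (T′ *ˢ)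
  *ˢ-mono T⊆T′ j (i , Ti , j≡i*) = i , T⊆T′ i Ti , j≡i*

  stronglyNormalClosed-resp : ∀ {T T′ : Sub} → T ⊆ˢ T′ → T′ ⊆ˢ T →
                              StronglyNormalClosed T → StronglyNormalClosed T′
  stronglyNormalClosed-resp T⊆T′ T′⊆T (((i , Ti) , closed) , normal) =
    ((i , T⊆T′ i Ti) , λ r h → T⊆T′ r (closed r (·-mono (*ˢ-mono T′⊆T) T′⊆T r h))) ,
    λ i r h → T⊆T′ r (normal i r (·-mono (·-mono (λ _ e → e) T′⊆T) (λ _ e → e) r h))

  ·⇒path : ∀ {U V : Sub} {x y} → (U · V) (rel x y) → ∃[ w ] U (rel x w) × V (rel w y)
  ·⇒path (u , v , Uu , Vv , h) with p>0⇒path h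
  ... | w , refl , refl = w , Uu , Vv

  path⇒· : ∀ {U V : Sub} {x w y} → U (rel x w) → V (rel w y) → (U · V) (rel x y)
  path⇒· {x = x} {w} {y} Uxw Vwy = rel x w , rel w y , Uxw , Vwy , path⇒p>0 refl refl

  module _ {T : Sub} (T-closed : Closed T) where

    private
      T*T⊆T : ((T *ˢ) · T) ⊆ˢ T
      T*T⊆T = proj₂ T-closed

    closed-zero : T zero
    closed-zero with proj₁ T-closed
    ... | i , Ti with nonempty i
    ... | x , y , xy = T*T⊆T zero (star i , i , (i , Ti , refl) , Ti ,
      subst (λ t → 0 < p (star i) i t) (rel-refl y) (path⇒p>0 (Equivalence.to rel-transpose xy) xy))

    closed-sym : ∀ {x y} → T (rel x y) → T (rel y x)
    closed-sym {x} {y} Txy = T*T⊆T (rel y x)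
      (rel y x , zero , (rel x y , Txy , star-rel x y) , closed-zero , path⇒p>0 refl (rel-refl x))

    closed-trans : ∀ {x y z} → T (rel x y) → T (rel y z) → T (rel x z)
    closed-trans {x} {y} {z} Txy Tyz =
      T*T⊆T (rel x z) (path⇒· (rel y x , closed-sym Txy , star-rel y x) Tyz)

  normal-conj : ∀ {T : Sub} → StronglyNormalClosed T →
                ∀ {i a b c e} → rel a b ≡ star i → T (rel b c) → rel c e ≡ i → T (rel a e)
  normal-conj (_ , normal) {i} {a} {b} {c} {e} ab Tbc ce =
    normal i (rel a e) (path⇒· (path⇒· ab Tbc) ce)

  Oupper-refl : ∀ x → Oupper (rel x x)
  Oupper-refl x T snc = subst (λ j → T j ≡ true) (sym (rel-refl x)) (closed-zero (proj₁ snc))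

  Oupper-trans : ∀ {x y z} → Oupper (rel x y) → Oupper (rel y z) → Oupper (rel x z)
  Oupper-trans Oxy Oyz T snc = closed-trans (proj₁ snc) (Oxy T snc) (Oyz T snc)

  Oupper-conj : ∀ {i a b c e} →
                rel a b ≡ star i → Oupper (rel b c) → rel c e ≡ i → Oupper (rel a e)
  Oupper-conj ab Obc ce T snc = normal-conj snc ab (Obc T snc) ce

  OupperOthin-fibre : ∀ {i x y z z′} → rel x z ≡ i → rel x z′ ≡ i →
                      (Oupper · Othin) (rel z y) → (Oupper · Othin) (rel z′ y)
  OupperOthin-fibre {x = x} {z = z} {z′} xz xz′ zy with ·⇒path zy
  ... | w , Ozw , wy = path⇒· (Oupper-trans Oz′z Ozw) wy
    where
    Oz′z : Oupper (rel z′ z)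
    Oz′z = Oupper-conj (Equivalence.to rel-transpose xz′) (Oupper-refl x) xz

  OupperOthin-refl : ∀ x → (Oupper · Othin) (rel x x)
  OupperOthin-refl x = path⇒· (Oupper-refl x) (subst Othin (sym (rel-refl x)) Othin-zero)

  OupperOthin-thin : ∀ {x y z} → Othin (rel x z) →
                     (Oupper · Othin) (rel z y) → (Oupper · Othin) (rel x y)
  OupperOthin-thin {x} {y} {z} xz-thin zy with ·⇒path zy
  ... | w , Ozw , wy with successor (star (rel x z)) w
  ... | w′ , ww′ = path⇒· Oxw′ (Othin-comp (subst Othin (sym w′w) xz-thin) wy)
    where
    w′w : rel w′ w ≡ rel x z
    w′w = Equivalence.from rel-transpose ww′
    Oxw′ : Oupper (rel x w′)
    Oxw′ = Oupper-conj (sym (star-involutive (rel x z))) Ozw ww′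

  _·?_ : ∀ {U V : Sub} → Decidable U → Decidable V → Decidable (U · V)
  (U? ·? V?) r = any? λ u → any? λ v → U? u ×-dec V? v ×-dec 0 <? p u v r

  _*ˢ? : ∀ {T : Sub} → Decidable T → Decidable (T *ˢ)
  (T? *ˢ?) j = any? λ i → T? i ×-dec j ≟ star i

  ⊆ˢ? : ∀ {U V : Sub} → Decidable U → Decidable V → Dec (U ⊆ˢ V)
  ⊆ˢ? U? V? = all? λ r → U? r →-dec V? r

  stronglyNormalClosed? : ∀ {T : Sub} → Decidable T → Dec (StronglyNormalClosed T)
  stronglyNormalClosed? T? =
    (any? T? ×-dec ⊆ˢ? ((T? *ˢ?) ·? T?) T?) ×-dec
    all? (λ i → ⊆ˢ? (((_≟ star i) ·? T?) ·? (_≟ i)) T?)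

  Oupper? : Decidable Oupper
  Oupper? r =
    map′ ¬counterexample⇒Oupper Oupper⇒¬counterexample (¬? (anySubset? counterexample?))
    where
    Counterexample : Pred (Subset D) 0ℓ
    Counterexample s = StronglyNormalClosed (λ j → lookup s j ≡ true) × lookup s r ≡ false

    counterexample? : Decidable Counterexample
    counterexample? s =
      stronglyNormalClosed? (λ j → lookup s j Bool.≟ true) ×-dec lookup s r Bool.≟ false

    Oupper⇒¬counterexample : Oupper r → ¬ ∃ Counterexample
    Oupper⇒¬counterexample Or (s , snc , sr≡false)
      with () ← trans (sym (Or (lookup s) snc)) sr≡false

    ¬counterexample⇒Oupper : ¬ ∃ Counterexample → Oupper r
    ¬counterexample⇒Oupper ¬cex T snc = ¬-not λ Tr≡false →
      ¬cex ( tabulate T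
           , stronglyNormalClosed-resp (λ j → trans (lookup∘tabulate T j))
                                       (λ j → trans (sym (lookup∘tabulate T j))) snc
           , trans (lookup∘tabulate T r) Tr≡false)

  Othin? : Decidable Othin
  Othin? i = k i ℕ.≟ 1

module FieldProperties {c ℓ} (F : Field c ℓ) where

  open Field F hiding (zero) renaming (refl to ≈-refl; sym to ≈-sym; trans to ≈-trans)
  open FieldOps F
  open import Algebra.Properties.Semiring.Mult semiring
    using (×1-homo-*) renaming (_×_ to _·1#_)
  open import Relation.Binary.Reasoning.Setoid setoid

  𝟙 : Bool → Carrier
  𝟙 b = if b then 1# else 0#

  ι≡·1# : ∀ m → ι m ≡ m ·1# 1#
  ι≡·1# zero    = refl
  ι≡·1# (suc m) = cong (1# +_) (ι≡·1# m)

  ι-* : ∀ m o → ι (m ℕ.* o) ≈ ι m * ι o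
  ι-* m o = begin
    ι (m ℕ.* o)            ≡⟨ ι≡·1# (m ℕ.* o) ⟩
    (m ℕ.* o) ·1# 1#       ≈⟨ ×1-homo-* m o ⟩
    (m ·1# 1#) * (o ·1# 1#) ≡⟨ cong₂ _*_ (ι≡·1# m) (ι≡·1# o) ⟨
    ι m * ι o               ∎

  ι-divisible : ∀ {q m} → ι q ≈ 0# → q ∣ m → ι m ≈ 0#
  ι-divisible {q} ιq≈0 (divides r refl) = begin
    ι (r ℕ.* q)  ≈⟨ ι-* r q ⟩
    ι r * ι q    ≈⟨ *-congˡ ιq≈0 ⟩
    ι r * 0#     ≈⟨ zeroʳ (ι r) ⟩
    0#           ∎

  ∑-cong : ∀ {m} {f g : Fin m → Carrier} → (∀ z → f z ≈ g z) → ∑ f ≈ ∑ g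
  ∑-cong {zero}  f≈g = ≈-refl
  ∑-cong {suc m} f≈g = +-cong (f≈g zero) (∑-cong (f≈g ∘ suc))

  ∑-zero : ∀ {m} (f : Fin m → Carrier) → (∀ z → f z ≈ 0#) → ∑ f ≈ 0#
  ∑-zero {zero}  f f≈0 = ≈-refl
  ∑-zero {suc m} f f≈0 =
    ≈-trans (+-cong (f≈0 zero) (∑-zero (f ∘ suc) (f≈0 ∘ suc))) (+-identityʳ 0#)

  ∑-𝟙 : ∀ {m} (b : Fin m → Bool) → ∑ (𝟙 ∘ b) ≈ ι (count b)
  ∑-𝟙 {zero}  b = ≈-refl
  ∑-𝟙 {suc m} b with b zero
  ... | true  = +-congˡ (∑-𝟙 (b ∘ suc))
  ... | false = ≈-trans (+-identityˡ _) (∑-𝟙 (b ∘ suc))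

  ∑-select : ∀ {m} (g : Fin m → Carrier) (j : Fin m) →
             ∑ (λ i → g i * 𝟙 ⌊ j ≟ i ⌋) ≈ g j
  ∑-select g zero = begin
    g zero * 1# + ∑ (λ i → g (suc i) * 0#)
      ≈⟨ +-cong (*-identityʳ (g zero)) (∑-zero _ (λ i → zeroʳ (g (suc i)))) ⟩
    g zero + 0#                             ≈⟨ +-identityʳ (g zero) ⟩
    g zero                                  ∎
  ∑-select g (suc j) = begin
    g zero * 0# + ∑ (λ i → g (suc i) * 𝟙 ⌊ suc j ≟ suc i ⌋)
      ≈⟨ +-cong (zeroʳ (g zero)) (∑-cong (λ i → *-congˡ (reflexive (cong 𝟙 (⌊⌋-map′ _ _ (j ≟ i)))))) ⟩
    0# + ∑ (λ i → g (suc i) * 𝟙 ⌊ j ≟ i ⌋)  ≈⟨ +-identityˡ _ ⟩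
    ∑ (λ i → g (suc i) * 𝟙 ⌊ j ≟ i ⌋)       ≈⟨ ∑-select (g ∘ suc) j ⟩
    g (suc j)                               ∎

  𝟙-∧ : ∀ a b → 𝟙 a * 𝟙 b ≈ 𝟙 (a ∧ b)
  𝟙-∧ true  b = *-identityˡ (𝟙 b)
  𝟙-∧ false b = zeroˡ (𝟙 b)

module IndicatorMatrices {c ℓ} (F : Field c ℓ) {n d} (S : AssocScheme n d) where

  open Field F hiding (zero) renaming (refl to ≈-refl; sym to ≈-sym; trans to ≈-trans)
  open SchemeAlgebra F S
  open AssocScheme S
  open SchemeProperties S
  open FieldProperties F
  open import Relation.Binary.Reasoning.Setoid setoid

  FibreConstant : Sub → Set
  FibreConstant V =
    ∀ {i x y z z′} → rel x z ≡ i → rel x z′ ≡ i → V (rel z y) → V (rel z′ y)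

  ThinInvariant : Sub → Set
  ThinInvariant V = ∀ {x y z} → Othin (rel x z) → V (rel z y) → V (rel x y)

  module _ {V : Sub} (V? : Decidable V) where

    J : Matrix n
    J x y = 𝟙 (does (V? (rel x y)))

    J-inFS : InFS J
    J-inFS = 𝟙 ∘ does ∘ V? , λ x y → ≈-sym (∑-select (𝟙 ∘ does ∘ V?) (rel x y))

    J-nonZero : ∀ {x y} → V (rel x y) → NonZero J
    J-nonZero {x} {y} Vxy J≈0 =
      1≉0 (≈-trans (reflexive (cong 𝟙 (sym (dec-true (V? (rel x y)) Vxy)))) (J≈0 x y))

    fibre∩V? : ∀ i x y → Decidable (λ z → rel x z ≡ i × V (rel z y))
    fibre∩V? i x y z = rel x z ≟ i ×-dec V? (rel z y)

    A⊗J≈count : ∀ i x y → (A̅ i ⊗ J) x y ≈ ι (count (does ∘ fibre∩V? i x y))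
    A⊗J≈count i x y = begin
      ∑ (λ z → 𝟙 ⌊ rel x z ≟ i ⌋ * 𝟙 (does (V? (rel z y))))
        ≈⟨ ∑-cong (λ z → 𝟙-∧ ⌊ rel x z ≟ i ⌋ (does (V? (rel z y)))) ⟩
      ∑ (λ z → 𝟙 (⌊ rel x z ≟ i ⌋ ∧ does (V? (rel z y))))
        ≈⟨ ∑-cong (λ z → reflexive (cong (λ b → 𝟙 (b ∧ _)) (isYes≗does (rel x z ≟ i)))) ⟩
      ∑ (𝟙 ∘ does ∘ fibre∩V? i x y)
        ≈⟨ ∑-𝟙 (does ∘ fibre∩V? i x y) ⟩
      ι (count (does ∘ fibre∩V? i x y))   ∎

    A⊗J-fibre : FibreConstant V →
                ∀ {i x y z} → rel x z ≡ i → (A̅ i ⊗ J) x y ≈ ι (k i) * J z y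
    A⊗J-fibre fibre {i} {x} {y} {z} xz with V? (rel z y)
    ... | yes Vzy = begin
      (A̅ i ⊗ J) x y                         ≈⟨ A⊗J≈count i x y ⟩
      ι (count (does ∘ fibre∩V? i x y))         ≡⟨ cong ι (count-⇔ (fibre∩V? i x y) (λ w → rel x w ≟ i) V-on-fibre) ⟩
      ι (count (λ w → does (rel x w ≟ i)))   ≡⟨ cong ι (k≡count i x) ⟨
      ι (k i)                                ≈⟨ *-identityʳ (ι (k i)) ⟨
      ι (k i) * 1#                           ∎
      where
      V-on-fibre : ∀ w → (rel x w ≡ i × V (rel w y)) ⇔ rel x w ≡ i
      V-on-fibre w = mk⇔ proj₁ (λ xw → xw , fibre xz xw Vzy)
    ... | no ¬Vzy = begin
      (A̅ i ⊗ J) x y                         ≈⟨ A⊗J≈count i x y ⟩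
      ι (count (does ∘ fibre∩V? i x y))         ≡⟨ cong ι (count≡0 (fibre∩V? i x y) ¬V-on-fibre) ⟩
      0#                                     ≈⟨ zeroʳ (ι (k i)) ⟨
      ι (k i) * 0#                           ∎
      where
      ¬V-on-fibre : ∀ w → ¬ (rel x w ≡ i × V (rel w y))
      ¬V-on-fibre w (xw , Vwy) = ¬Vzy (fibre xw xz Vwy)

    J-thin-invariant : ThinInvariant V → ∀ {x y z} → Othin (rel x z) → J z y ≡ J x y
    J-thin-invariant thin-inv {x} {y} {z} xz-thin =
      cong 𝟙 (does-⇔ (mk⇔ (thin-inv xz-thin) (thin-inv zx-thin)) (V? (rel z y)) (V? (rel x y)))
      where
      zx-thin : Othin (rel z x)
      zx-thin = subst Othin (sym (star-rel x z)) (Othin-star xz-thin)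

  module _ (vanishing : ∀ i → ¬ Othin i → ι (k i) ≈ 0#) where

    J-trivial : ∀ {V : Sub} (V? : Decidable V) → FibreConstant V → ThinInvariant V →
                (∀ x → V (rel x x)) → TrivialGen (J V?)
    J-trivial V? fibre thin-inv V-refl =
      J-inFS V? , J-nonZero V? (V-refl (proj₁ (nonempty zero))) , eigen
      where
      eigen : ∀ i x y → (A̅ i ⊗ J V?) x y ≈ ι (k i) * J V? x y
      eigen i x y with successor i x | Othin? i
      ... | z , xz | yes i-thin = begin
        (A̅ i ⊗ J V?) x y  ≈⟨ A⊗J-fibre V? fibre xz ⟩
        ι (k i) * J V? z y
          ≡⟨ cong (ι (k i) *_) (J-thin-invariant V? thin-inv (subst Othin (sym xz) i-thin)) ⟩
        ι (k i) * J V? x y ∎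
      ... | z , xz | no ¬i-thin = begin
        (A̅ i ⊗ J V?) x y  ≈⟨ A⊗J-fibre V? fibre xz ⟩
        ι (k i) * J V? z y ≈⟨ *-congʳ (vanishing i ¬i-thin) ⟩
        0# * J V? z y     ≈⟨ zeroˡ (J V? z y) ⟩
        0#                ≈⟨ zeroˡ (J V? x y) ⟨
        0# * J V? x y     ≈⟨ *-congʳ (vanishing i ¬i-thin) ⟨
        ι (k i) * J V? x y ∎

    all-ones-trivial : TrivialGen (J U?)
    all-ones-trivial = J-trivial U? (λ _ _ _ → tt) (λ _ _ → tt) (λ _ → tt)

    p-transitive⇒total : PTransitive → ∀ {V : Sub} (V? : Decidable V) →
                         TrivialGen (J V?) → ∀ r → V r
    p-transitive⇒total (_ , unique) V? J-triv r with nonempty r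
    ... | x , y , refl with V? (rel x y)
    ... | yes Vxy = Vxy
    ... | no ¬Vxy with unique (J U?) (J V?) all-ones-trivial J-triv
    ...   | _ , λ₂ , 1≈λ₂J = contradiction (≈-trans (1≈λ₂J x y) λ₂J≈0) 1≉0
      where
      λ₂J≈0 : λ₂ * J V? x y ≈ 0#
      λ₂J≈0 = ≈-trans (*-congˡ (reflexive (cong 𝟙 (dec-false (V? (rel x y)) ¬Vxy)))) (zeroʳ λ₂)

corollary3p8 : ∀ {c ℓ} (F : Field c ℓ) (p : ℕ) → FieldOps.HasChar F p →
    ∀ {n d} (S : AssocScheme n d) →
    (∀ (i : Fin (AssocScheme.D S)) → ¬ AssocScheme.Othin S i → p ∣ AssocScheme.k S i) →
    SchemeAlgebra.PTransitive F S →
    ∀ (r : Fin (AssocScheme.D S)) →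
      AssocScheme._·_ S (AssocScheme.Oupper S) (AssocScheme.Othin S) r
corollary3p8 F p (_ , ιp≈0 , _) S p∣k p-transitive =
  p-transitive⇒total vanishing p-transitive (Oupper? ·? Othin?)
    (J-trivial vanishing (Oupper? ·? Othin?) OupperOthin-fibre OupperOthin-thin OupperOthin-refl)
  where
  open AssocScheme S using (k; Othin)
  open Field F using (_≈_; 0#)
  open FieldOps F using (ι)
  open FieldProperties F using (ι-divisible)
  open SchemeProperties S
  open IndicatorMatrices F S

  vanishing : ∀ i → ¬ Othin i → ι (k i) ≈ 0#
  vanishing i ¬thin = ι-divisible ιp≈0 (p∣k i ¬thin)
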